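{- Let $k\ge0$ be an integer. (1) If $b>1$ is an integer, then $0<Z_b(b^{k+1})-bZ_b(b^k)$. (2) If $b$ is a prime power, then $0<Z_b(b^{k+1})-bZ_b(b^k)<b$.
   Context: $Z_b(m)$ is the number of trailing zeroes in the base-$b$ expansion of $m!$, i.e. the largest $e\ge0$ with $b^e\mid m!$. -}

module Defs where

open import Data.Nat using (ℕ; zero; suc; _+_; _*_; _^_; _!)
open import Data.Nat.Divisibility using (_∣?_)
open import Relation.Nullary.Decidable using (does)
open import Data.Bool using (if_then_else_)

maxPowDiv : ℕ → ℕ → ℕ → ℕ
maxPowDiv b n zero      = 0
maxPowDiv b n (suc e)   = if does (b ^ suc e ∣? n) then suc e else maxPowDiv b n e

-- Z b m : number of trailing zeroes of m! in base b, i.e. the largest e with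
-- b ^ e ∣ m !.  For b > 1 any such e satisfies e < b ^ e ≤ m !, so searching
-- e ≤ m ! finds the true maximum.
Z : ℕ → ℕ → ℕ
Z b m = maxPowDiv b (m !) (m !)

module Submission where

-- Lower bound, for every b > 1 and m > 0.  The factorial (b * m) ! contains
-- the b blocks (i * m + 1) … ((i + 1) * m), each a multiple of m !, and its top
-- factor b * m carries an additional factor b; hence b * (m !) ^ b ∣ (b * m) !
-- and b ^ (b * Z b m + 1) ∣ (b * m) !, i.e. b * Z b m < Z b (b * m).
--
-- Upper bound, for b = p ^ n with p prime.  We track p-adic valuations exactly:
-- (p * m) ! = p ^ m * m ! * R with p ∤ R, so the valuation of (p ^ N) ! is the
-- geometric sum G N = 1 + p + … + p ^ (N - 1) (Legendre's formula for prime
-- powers).  Since Z (p ^ n) m = ⌊ v_p(m !) / n ⌋, the identity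
-- G (N + n) = G n + p ^ n * G N together with G n < p ^ n gives
-- Z b (p ^ (N + n)) < b * Z b (p ^ N) + b.  Taking N = n * k yields the theorem.

open import Defs
open import Data.Nat using (ℕ; _+_; _*_; _^_; _<_; _>_)
open import Data.Nat.Primality using (Prime)
open import Data.Product using (_×_; Σ; _,_)
open import Data.Product using (proj₁; proj₂)

open import Data.Nat using (pred; zero; suc; _∸_; _≤_; _!; z≤n; s≤s; NonZero; nonTrivial⇒n>1; _<?_)
open import Data.Nat.Properties
open import Data.Nat.Divisibility
open import Data.Nat.Primality using (prime⇒nonZero; prime⇒nonTrivial; euclidsLemma)
open import Data.Nat.Combinatorics using (k![n∸k]!∣n!)
open import Data.Nat.Solver using (module +-*-Solver)
open import Data.Sum using (inj₁; inj₂)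
open import Data.Empty using (⊥-elim)
open import Relation.Nullary using (¬_; yes; no)
open import Relation.Binary.PropositionalEquality
open +-*-Solver using (solve; _:+_; _:*_; _:=_; con)

maxPowDiv-divides : ∀ b n bound → b ^ maxPowDiv b n bound ∣ n
maxPowDiv-divides b n zero = 1∣ n
maxPowDiv-divides b n (suc e) with b ^ suc e ∣? n
... | yes b^[e+1]∣n = b^[e+1]∣n
... | no _ = maxPowDiv-divides b n e

maxPowDiv-maximal : ∀ b n bound e → e ≤ bound → b ^ e ∣ n → e ≤ maxPowDiv b n bound
maxPowDiv-maximal b n zero e e≤0 _ = e≤0
maxPowDiv-maximal b n (suc bound) e e≤bound b^e∣n with b ^ suc bound ∣? n
... | yes _ = e≤bound
... | no b^bound∤n with m≤n⇒m<n∨m≡n e≤bound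
...   | inj₁ (s≤s e≤bound′) = maxPowDiv-maximal b n bound e e≤bound′ b^e∣n
...   | inj₂ refl = ⊥-elim (b^bound∤n b^e∣n)

-- Exponents grow slower than powers; this justifies the search bound m ! in Z.
exponent<power : ∀ b → 1 < b → ∀ e → e < b ^ e
exponent<power b 1<b zero = s≤s z≤n
exponent<power b@(suc _) 1<b (suc e) = begin-strict
  suc e              ≤⟨ exponent<power b 1<b e ⟩
  b ^ e              <⟨ m<m*n (b ^ e) b {{m^n≢0 b e}} 1<b ⟩
  b ^ e * b          ≡⟨ *-comm (b ^ e) b ⟩
  b ^ suc e          ∎
  where open ≤-Reasoning

Z-divides : ∀ b m → b ^ Z b m ∣ m !
Z-divides b m = maxPowDiv-divides b (m !) (m !)

Z-maximal : ∀ b m e → 1 < b → b ^ e ∣ m ! → e ≤ Z b m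
Z-maximal b m e 1<b b^e∣m! = maxPowDiv-maximal b (m !) (m !) e e≤m! b^e∣m!
  where
  e≤m! : e ≤ m !
  e≤m! = ≤-trans (<⇒≤ (exponent<power b 1<b e)) (∣⇒≤ {{m !≢0}} b^e∣m!)

-- a ! * c ! ∣ (a + c) ! : binomial coefficients are integers.
factorial-split : ∀ a c → a ! * c ! ∣ (a + c) !
factorial-split a c =
  subst (λ t → a ! * t ! ∣ (a + c) !) (m+n∸m≡n a c) (k![n∸k]!∣n! (m≤m+n a c))

-- (m !) ^ j ∣ (j * m) ! : split (j * m) ! into j blocks of length m.
factorial-power : ∀ m j → (m !) ^ j ∣ (j * m) !
factorial-power m zero = ∣-refl
factorial-power m (suc j) =
  ∣-trans (*-monoʳ-∣ (m !) (factorial-power m j)) (factorial-split m (j * m))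

^-preserves-∣ : ∀ {x y} j → x ∣ y → x ^ j ∣ y ^ j
^-preserves-∣ zero _ = ∣-refl
^-preserves-∣ (suc j) x∣y = *-pres-∣ x∣y (^-preserves-∣ j x∣y)

-- The top factor b * m of (b * m) ! supplies one more factor b beyond the blocks:
-- (b * m) ! = (b * m) * (d + c * m) ! with b = c + 1 and m = d + 1, and
-- b * (m ! * (m !) ^ c) = (b * m) * (d ! * (m !) ^ c).
factorial-power-extra : ∀ b m → .{{NonZero b}} → .{{NonZero m}} → b * (m !) ^ b ∣ (b * m) !
factorial-power-extra b@(suc c) m@(suc d) =
  subst (_∣ (b * m) !) regroup
    (*-monoʳ-∣ (b * m) (∣-trans (*-monoʳ-∣ (d !) (factorial-power m c)) (factorial-split d (c * m))))
  where
  regroup : (b * m) * (d ! * (m !) ^ c) ≡ b * (m !) ^ b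
  regroup = solve 4 (λ B M D P → (B :* M) :* (D :* P) := B :* ((M :* D) :* P))
                  refl b m (d !) ((m !) ^ c)

Z-scaling-lower : ∀ b m → 1 < b → 0 < m → b * Z b m < Z b (b * m)
Z-scaling-lower b@(suc _) m@(suc _) 1<b _ = Z-maximal b (b * m) (suc (b * z)) 1<b b^[bz+1]∣[bm]!
  where
  z = Z b m
  b^bz∣m!^b : b ^ (b * z) ∣ (m !) ^ b
  b^bz∣m!^b = subst (_∣ (m !) ^ b) (trans (^-*-assoc b z b) (cong (b ^_) (*-comm z b)))
                    (^-preserves-∣ b (Z-divides b m))
  b^[bz+1]∣[bm]! : b ^ suc (b * z) ∣ (b * m) !
  b^[bz+1]∣[bm]! = ∣-trans (*-monoʳ-∣ b b^bz∣m!^b) (factorial-power-extra b m)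

geometricSum : ℕ → ℕ → ℕ
geometricSum p zero = 0
geometricSum p (suc N) = p ^ N + geometricSum p N

geometricSum<power : ∀ p → 1 < p → ∀ n → geometricSum p n < p ^ n
geometricSum<power p 1<p zero = s≤s z≤n
geometricSum<power p 1<p (suc n) = begin-strict
  p ^ n + geometricSum p n  <⟨ +-monoʳ-< (p ^ n) (geometricSum<power p 1<p n) ⟩
  p ^ n + p ^ n             ≡⟨ cong (p ^ n +_) (sym (+-identityʳ (p ^ n))) ⟩
  2 * p ^ n                 ≤⟨ *-monoˡ-≤ (p ^ n) 1<p ⟩
  p * p ^ n                 ∎
  where open ≤-Reasoning

geometricSum-+ : ∀ p N n → geometricSum p (N + n) ≡ geometricSum p n + p ^ n * geometricSum p N
geometricSum-+ p zero n = sym (trans (cong (geometricSum p n +_) (*-zeroʳ (p ^ n))) (+-identityʳ _))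
geometricSum-+ p (suc N) n = begin
  p ^ (N + n) + geometricSum p (N + n)
    ≡⟨ cong₂ _+_ (^-distribˡ-+-* p N n) (geometricSum-+ p N n) ⟩
  p ^ N * p ^ n + (geometricSum p n + p ^ n * geometricSum p N)
    ≡⟨ solve 4 (λ a b c d → a :* b :+ (c :+ b :* d) := c :+ b :* (a :+ d))
             refl (p ^ N) (p ^ n) (geometricSum p n) (geometricSum p N) ⟩
  geometricSum p n + p ^ n * (p ^ N + geometricSum p N) ∎
  where open ≡-Reasoning

power-divides-power : ∀ p {c a} → c ≤ a → p ^ c ∣ p ^ a
power-divides-power p {c} {a} c≤a =
  subst (p ^ c ∣_) (trans (sym (^-distribˡ-+-* p c (a ∸ c))) (cong (p ^_) (m+[n∸m]≡n c≤a)))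
        (m∣m*n (p ^ (a ∸ c)))

-- Exact p-adic valuations

record HasValuation (p x e : ℕ) : Set where
  constructor valuation
  field
    cofactor      : ℕ
    factorisation : x ≡ p ^ e * cofactor
    p∤cofactor    : ¬ p ∣ cofactor

module _ {p : ℕ} (p-prime : Prime p) where

  1<p : 1 < p
  1<p = nonTrivial⇒n>1 p {{prime⇒nonTrivial p-prime}}

  p∤1 : ¬ p ∣ 1
  p∤1 p∣1 = <⇒≱ 1<p (∣⇒≤ p∣1)

  p∤* : ∀ {x y} → ¬ p ∣ x → ¬ p ∣ y → ¬ p ∣ x * y
  p∤* p∤x p∤y p∣xy with euclidsLemma _ _ p-prime p∣xy
  ... | inj₁ p∣x = p∤x p∣x
  ... | inj₂ p∣y = p∤y p∣y

  valuation-unit : ∀ {R} → ¬ p ∣ R → HasValuation p R 0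
  valuation-unit {R} p∤R = valuation R (sym (*-identityˡ R)) p∤R

  valuation-power : ∀ e → HasValuation p (p ^ e) e
  valuation-power e = valuation 1 (sym (*-identityʳ (p ^ e))) p∤1

  valuation-* : ∀ {x y a c} → HasValuation p x a → HasValuation p y c → HasValuation p (x * y) (a + c)
  valuation-* {x} {y} {a} {c} (valuation R x≡ p∤R) (valuation S y≡ p∤S) = valuation (R * S) xy≡ (p∤* p∤R p∤S)
    where
    xy≡ : x * y ≡ p ^ (a + c) * (R * S)
    xy≡ = begin
      x * y                         ≡⟨ cong₂ _*_ x≡ y≡ ⟩
      (p ^ a * R) * (p ^ c * S)     ≡⟨ solve 4 (λ A R′ C S′ → (A :* R′) :* (C :* S′) := (A :* C) :* (R′ :* S′))
                                              refl (p ^ a) R (p ^ c) S ⟩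
      (p ^ a * p ^ c) * (R * S)     ≡⟨ cong (_* (R * S)) (sym (^-distribˡ-+-* p a c)) ⟩
      p ^ (a + c) * (R * S)         ∎
      where open ≡-Reasoning

  valuation-maximal : ∀ {x a} c → HasValuation p x a → p ^ c ∣ x → c ≤ a
  valuation-maximal zero _ _ = z≤n
  valuation-maximal {a = zero} (suc c) (valuation R refl p∤R) p^c∣R =
    ⊥-elim (p∤R (∣-trans (m∣m*n (p ^ c)) (subst (p ^ suc c ∣_) (*-identityˡ R) p^c∣R)))
  valuation-maximal {a = suc a} (suc c) (valuation R refl p∤R) p^c∣x =
    s≤s (valuation-maximal c (valuation R refl p∤R)
          (*-cancelˡ-∣ p {{prime⇒nonZero p-prime}} (subst (p ^ suc c ∣_) (*-assoc p (p ^ a) R) p^c∣x)))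

  -- Legendre's formula for (p ^ N) !

  rising : ℕ → ℕ → ℕ
  rising a zero = 1
  rising a (suc j) = (a + suc j) * rising a j

  factorial-rising : ∀ a j → (a + j) ! ≡ a ! * rising a j
  factorial-rising a zero = trans (cong _! (+-identityʳ a)) (sym (*-identityʳ (a !)))
  factorial-rising a (suc j) = begin
    (a + suc j) !                        ≡⟨ cong _! (+-suc a j) ⟩
    suc (a + j) * (a + j) !              ≡⟨ cong (suc (a + j) *_) (factorial-rising a j) ⟩
    suc (a + j) * (a ! * rising a j)     ≡⟨ solve 3 (λ s f r → s :* (f :* r) := f :* (s :* r)) refl (suc (a + j)) (a !) (rising a j) ⟩
    a ! * (suc (a + j) * rising a j)     ≡⟨ cong (λ t → a ! * (t * rising a j)) (sym (+-suc a j)) ⟩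
    a ! * rising a (suc j)               ∎
    where open ≡-Reasoning

  -- Between consecutive multiples of p there are no multiples of p.
  p∤rising : ∀ m j → j < p → ¬ p ∣ rising (p * m) j
  p∤rising m zero _ = p∤1
  p∤rising m (suc j) j<p = p∤* p∤factor (p∤rising m j (<⇒≤ j<p))
    where
    p∤factor : ¬ p ∣ p * m + suc j
    p∤factor p∣ = <⇒≱ j<p (∣⇒≤ (∣m+n∣m⇒∣n p∣ (m∣m*n m)))

  -- The multiples p, 2p, …, mp contribute exactly p ^ m * m ! to (p * m) !.
  factorial-multiples : ∀ m → Σ ℕ λ R → (p * m) ! ≡ p ^ m * m ! * R × ¬ p ∣ R
  factorial-multiples zero = 1 , cong _! (*-zeroʳ p) , p∤1
  factorial-multiples (suc m) with factorial-multiples m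
  ... | R , eqR , p∤R = R * rising (p * m) q , eq , p∤* p∤R (p∤rising m q (≤-reflexive 1+q≡p))
    where
    q = pred p
    1+q≡p : suc q ≡ p
    1+q≡p = suc-pred p {{prime⇒nonZero p-prime}}
    p[m+1]≡ : p * suc m ≡ suc (p * m + q)
    p[m+1]≡ = begin
      p * suc m      ≡⟨ *-suc p m ⟩
      p + p * m      ≡⟨ cong (_+ p * m) (sym 1+q≡p) ⟩
      suc (q + p * m) ≡⟨ cong suc (+-comm q (p * m)) ⟩
      suc (p * m + q) ∎
      where open ≡-Reasoning
    eq : (p * suc m) ! ≡ p ^ suc m * suc m ! * (R * rising (p * m) q)
    eq = begin
      (p * suc m) !                                   ≡⟨ cong _! p[m+1]≡ ⟩
      suc (p * m + q) * (p * m + q) !                 ≡⟨ cong₂ _*_ (sym p[m+1]≡) (factorial-rising (p * m) q) ⟩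
      (p * suc m) * ((p * m) ! * rising (p * m) q)    ≡⟨ cong (λ t → (p * suc m) * (t * rising (p * m) q)) eqR ⟩
      (p * suc m) * (p ^ m * m ! * R * rising (p * m) q)
        ≡⟨ solve 6 (λ x sm P F r Q′ → (x :* sm) :* (P :* F :* r :* Q′) := (x :* P) :* (sm :* F) :* (r :* Q′))
                 refl p (suc m) (p ^ m) (m !) R (rising (p * m) q) ⟩
      p ^ suc m * suc m ! * (R * rising (p * m) q)    ∎
      where open ≡-Reasoning

  valuation-step : ∀ {m a} → HasValuation p (m !) a → HasValuation p ((p * m) !) (m + a)
  valuation-step {m} {a} v[m!] with factorial-multiples m
  ... | R , eq , p∤R = subst₂ (HasValuation p) (sym eq) (+-identityʳ (m + a))
                          (valuation-* (valuation-* (valuation-power m) v[m!]) (valuation-unit p∤R))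

  valuation-factorial-power : ∀ N → HasValuation p ((p ^ N) !) (geometricSum p N)
  valuation-factorial-power zero = valuation-unit p∤1
  valuation-factorial-power (suc N) = valuation-step (valuation-factorial-power N)

  1<p^n : ∀ n → 0 < n → 1 < p ^ n
  1<p^n n 0<n = ^-monoʳ-< p 1<p {0} {n} 0<n

  -- The two inequalities characterising the floor ⌊ a / n ⌋.
  Z-prime-power : ∀ n → 0 < n → ∀ m {a} → HasValuation p (m !) a →
                  n * Z (p ^ n) m ≤ a × a < n * suc (Z (p ^ n) m)
  Z-prime-power n 0<n m {a} v[m!]@(valuation R m!≡ _) = floor≤ , a<floor+1
    where
    z = Z (p ^ n) m
    floor≤ : n * z ≤ a
    floor≤ = valuation-maximal (n * z) v[m!] (subst (_∣ m !) (^-*-assoc p n z) (Z-divides (p ^ n) m))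
    a<floor+1 : a < n * suc z
    a<floor+1 with a <? n * suc z
    ... | yes a<n[z+1] = a<n[z+1]
    ... | no a≮n[z+1] = ⊥-elim (<-irrefl refl (Z-maximal (p ^ n) m (suc z) (1<p^n n 0<n) [p^n]^[z+1]∣m!))
      where
      [p^n]^[z+1]∣m! : (p ^ n) ^ suc z ∣ m !
      [p^n]^[z+1]∣m! = subst₂ _∣_ (sym (^-*-assoc p n (suc z))) (sym m!≡)
                         (∣-trans (power-divides-power p (≮⇒≥ a≮n[z+1])) (m∣m*n R))

  Z-scaling-upper : ∀ n → 0 < n → ∀ N →
                    Z (p ^ n) (p ^ (N + n)) < p ^ n * Z (p ^ n) (p ^ N) + p ^ n
  Z-scaling-upper n 0<n N = *-cancelˡ-< n _ _ n*z′<n*[bz+b]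
    where
    b = p ^ n
    z = Z b (p ^ N)
    z′ = Z b (p ^ (N + n))
    G = geometricSum p
    n*z′<n*[bz+b] : n * z′ < n * (b * z + b)
    n*z′<n*[bz+b] = begin-strict
      n * z′              ≤⟨ proj₁ (Z-prime-power n 0<n (p ^ (N + n)) (valuation-factorial-power (N + n))) ⟩
      G (N + n)           ≡⟨ geometricSum-+ p N n ⟩
      G n + b * G N       <⟨ +-monoˡ-< (b * G N) (geometricSum<power p 1<p n) ⟩
      b + b * G N         ≡⟨ sym (*-suc b (G N)) ⟩
      b * suc (G N)       ≤⟨ *-monoʳ-≤ b (proj₂ (Z-prime-power n 0<n (p ^ N) (valuation-factorial-power N))) ⟩
      b * (n * suc z)     ≡⟨ solve 3 (λ B N′ Z′ → B :* (N′ :* (con 1 :+ Z′)) := N′ :* (B :* Z′ :+ B)) refl b n z ⟩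
      n * (b * z + b)     ∎
      where open ≤-Reasoning

lemma2 : (k : ℕ) →
    ((b : ℕ) → b > 1 → b * Z b (b ^ k) < Z b (b ^ (k + 1)))
    × ((p n : ℕ) → Prime p → n > 0 →
        let b = p ^ n in
        b * Z b (b ^ k) < Z b (b ^ (k + 1))
        × Z b (b ^ (k + 1)) < b * Z b (b ^ k) + b)
lemma2 k = lower , λ p n p-prime 0<n → lower (p ^ n) (1<p^n p-prime n 0<n) , upper p n p-prime 0<n
  where
  b^[k+1]≡b*b^k : ∀ b → b ^ (k + 1) ≡ b * b ^ k
  b^[k+1]≡b*b^k b = cong (b ^_) (+-comm k 1)

  lower : ∀ b → b > 1 → b * Z b (b ^ k) < Z b (b ^ (k + 1))
  lower b@(suc _) 1<b = subst (λ t → b * Z b (b ^ k) < Z b t) (sym (b^[k+1]≡b*b^k b))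
                  (Z-scaling-lower b (b ^ k) 1<b (m^n>0 b k))

  -- With b = p ^ n we have b ^ k = p ^ (n * k) and b ^ (k + 1) = p ^ (n * k + n).
  upper : ∀ p n → Prime p → n > 0 → Z (p ^ n) ((p ^ n) ^ (k + 1)) < p ^ n * Z (p ^ n) ((p ^ n) ^ k) + p ^ n
  upper p n p-prime 0<n = subst₂ (λ s t → Z (p ^ n) t < p ^ n * Z (p ^ n) s + p ^ n)
                          (sym (^-*-assoc p n k)) b^[k+1]≡
                          (Z-scaling-upper p-prime n 0<n (n * k))
    where
    b^[k+1]≡ : p ^ (n * k + n) ≡ (p ^ n) ^ (k + 1)
    b^[k+1]≡ = begin
      p ^ (n * k + n)       ≡⟨ cong (p ^_) (trans (+-comm (n * k) n) (sym (*-suc n k))) ⟩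
      p ^ (n * suc k)       ≡⟨ ^-*-assoc p n (suc k) ⟨
      (p ^ n) ^ suc k       ≡⟨ b^[k+1]≡b*b^k (p ^ n) ⟨
      (p ^ n) ^ (k + 1)     ∎
      where open ≡-Reasoning
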